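{- Let $r \geq 4$. There exist $r$-graphs $G$ with maximum degree $\Delta$, for arbitrarily large $\Delta$, such that as $\Delta \rightarrow \infty$, \[ \mathrm{ex}(G,T^r)=O(\Delta^{ -\frac{1}{2}}) \cdot e(G).\]
   Context: An $r$-graph is an $r$-uniform hypergraph; $e(G)$ denotes its number of edges and the degree of a vertex is the number of edges containing it. A loose triangle $T^r$ is the $r$-graph consisting of three edges $e,f,g$ with $|e\cap f|=|f\cap g|=|g\cap e|=1$ and $e\cap f\cap g=\emptyset$. For $r$-graphs $G,F$, $\mathrm{ex}(G,F)$ is the maximum number of edges in a subgraph of $G$ containing no copy of $F$. -}

module Defs where

open import Data.Nat using (ℕ; _≤_; _*_)
open import Data.Fin using (Fin)
open import Data.Fin.Subset using (Subset; ∣_∣; _∩_; ⊥; _∈_)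
open import Data.Fin.Subset.Properties using (_∈?_)
open import Data.List using (List; length; filter)
open import Data.List.Relation.Unary.All using (All)
open import Data.List.Relation.Unary.Unique.Propositional using (Unique)
import Data.List.Membership.Propositional as LM
open import Data.Product using (Σ; _×_; ∃)
open import Relation.Binary.PropositionalEquality using (_≡_)
open import Relation.Nullary using (¬_)

record RGraph (r n : ℕ) : Set where
  field
    edges    : List (Subset n)
    uniform  : All (λ e → ∣ e ∣ ≡ r) edges
    distinct : Unique edges
open RGraph public

e : ∀ {r n} → RGraph r n → ℕ
e G = length (edges G)

degree : ∀ {r n} → RGraph r n → Fin n → ℕ
degree G v = length (filter (v ∈?_) (edges G))

MaxDegree : ∀ {r n} → RGraph r n → ℕ → Set
MaxDegree G Δ = (∀ v → degree G v ≤ Δ) × ∃ λ v → degree G v ≡ Δ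

SubgraphOf : ∀ {r n} → RGraph r n → RGraph r n → Set
SubgraphOf H G = All (λ f → f LM.∈ edges G) (edges H)

ContainsLooseTriangle : ∀ {r n} → RGraph r n → Set
ContainsLooseTriangle {n = n} H =
  Σ (Subset n) λ a → Σ (Subset n) λ b → Σ (Subset n) λ c →
    (a LM.∈ edges H) × (b LM.∈ edges H) × (c LM.∈ edges H) ×
    (∣ a ∩ b ∣ ≡ 1) × (∣ b ∩ c ∣ ≡ 1) × (∣ c ∩ a ∣ ≡ 1) ×
    (a ∩ b ∩ c ≡ ⊥)

-- Take G to be K(m, m, m), the complete 3-partite 3-graph on three copies of
-- [m], with every edge enlarged by r - 3 private vertices: e(G) = m³ and
-- Δ = m².  If a point t of [m]³ has neighbours along all three axes, say
-- x′yz, xy′z and xyz′, their edges pairwise share exactly one vertex and have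
-- none in common, i.e. form a loose triangle.  So in a T^r-free subgraph H
-- every point misses a neighbour along some axis; in particular every edge of
-- H is alone on one of the three axis-parallel lines through its core, and
-- such a line is fixed by the other two coordinates.  Hence e(H) ≤ 3m², that
-- is e(H) ≤ 3 e(G) / √Δ.
module Submission where

open import Defs
open import Data.Nat using (ℕ; zero; suc; _+_; _*_; _≤_; z≤n; s≤s)
open import Data.Nat.Properties
  using (≤-trans; ≤-refl; ≤-reflexive; ≤-antisym; n≤1+n; m≤m*n; +-mono-≤; *-mono-≤; +-identityʳ; module ≤-Reasoning)
open import Data.Nat.Tactic.RingSolver using (solve-∀)
open import Data.Fin using (Fin; zero; suc; combine; remQuot; inject≤)
open import Data.Fin.Patterns using (0F; 1F; 2F)
open import Data.Fin.Properties
  using (any?; ¬∀⟶∃¬; combine-remQuot; remQuot-combine; combine-injective; combine-injectiveʳ; inject≤-injective; _≟_)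
open import Data.Fin.Subset using (Subset; ∣_∣; _∩_; ⊥; ⁅_⁆; inside; outside) renaming (_∈_ to _∈ˢ_)
open import Data.Fin.Subset.Properties
  using (x∈⁅x⁆; x∈⁅y⁆⇒x≡y; ∣⁅x⁆∣≡1; x∈p∩q⁺; x∈p∩q⁻; ⊆-antisym; Empty-unique)
  renaming (_∈?_ to _∈ˢ?_)
open import Data.Vec using ([]; _∷_; _++_; lookup)
open import Data.Vec.Properties using (lookup-++ˡ; lookup-++ʳ; []=⇒lookup; lookup⇒[]=)
open import Data.List using (List; []; _∷_; length; map; filter; cartesianProduct; allFin)
  renaming (_++_ to _++ᴸ_)
open import Data.List.Properties using (length-map; length-++; length-++-sucʳ; length-tabulate)
open import Data.List.Membership.Propositional using (_∈_)
open import Data.List.Membership.Propositional.Properties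
  using (∈-∃++; ∈-++⁺ˡ; ∈-++⁺ʳ; ∈-++⁻; ∈-map⁺; ∈-map⁻; ∈-filter⁺; ∈-filter⁻
        ; ∈-cartesianProduct⁺; ∈-allFin)
open import Data.List.Relation.Binary.Subset.Propositional using (_⊆_)
open import Data.List.Relation.Unary.Any using (here; there)
open import Data.List.Relation.Unary.All as All using (All; []; _∷_)
import Data.List.Relation.Unary.All.Properties as All
open import Data.List.Relation.Unary.AllPairs using ([]; _∷_)
open import Data.List.Relation.Unary.Unique.Propositional using (Unique)
import Data.List.Relation.Unary.Unique.Propositional.Properties as Unique
open import Data.Product using (Σ; _×_; _,_; proj₁; proj₂; ∃)
open import Data.Product.Properties using (≡-dec)
open import Data.Sum using (inj₁; inj₂)
open import Data.Bool using (true; false)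
open import Data.Empty using (⊥-elim)
open import Function using (_∘_; id)
open import Relation.Nullary using (¬_; Dec; yes; no; does; ¬?; _×-dec_)
open import Relation.Unary using (Pred; Decidable)
open import Relation.Binary.PropositionalEquality
  using (_≡_; _≢_; refl; sym; trans; cong; cong₂; subst; module ≡-Reasoning)

module _ {A : Set} where

  length-mono-⊆ : {xs ys : List A} → Unique xs → xs ⊆ ys → length xs ≤ length ys
  length-mono-⊆ {[]}     _          _     = z≤n
  length-mono-⊆ {x ∷ xs} (x∉xs ∷ xs!) xs⊆ys with ∈-∃++ (xs⊆ys (here refl))
  ... | ys₁ , ys₂ , refl = begin
    suc (length xs)               ≤⟨ s≤s (length-mono-⊆ xs! xs⊆ys₁++ys₂) ⟩
    suc (length (ys₁ ++ᴸ ys₂))    ≡⟨ sym (length-++-sucʳ ys₁ x ys₂) ⟩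
    length (ys₁ ++ᴸ x ∷ ys₂)      ∎
    where
    open ≤-Reasoning
    xs⊆ys₁++ys₂ : xs ⊆ ys₁ ++ᴸ ys₂
    xs⊆ys₁++ys₂ y∈xs with ∈-++⁻ ys₁ (xs⊆ys (there y∈xs))
    ... | inj₁ y∈ys₁         = ∈-++⁺ˡ y∈ys₁
    ... | inj₂ (here y≡x)    = ⊥-elim (All.lookup x∉xs y∈xs (sym y≡x))
    ... | inj₂ (there y∈ys₂) = ∈-++⁺ʳ ys₁ y∈ys₂

module _ {A B : Set} (f : A → B) where

  InjectiveOn : List A → Set
  InjectiveOn xs = ∀ {a b} → a ∈ xs → b ∈ xs → f a ≡ f b → a ≡ b

  map⁺-injectiveOn : ∀ {xs} → InjectiveOn xs → Unique xs → Unique (map f xs)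
  map⁺-injectiveOn         _   []           = []
  map⁺-injectiveOn {x ∷ _} inj (x∉xs ∷ xs!) =
    All.map⁺ (All.tabulate λ y∈xs fx≡fy → All.lookup x∉xs y∈xs (inj (here refl) (there y∈xs) fx≡fy))
    ∷ map⁺-injectiveOn (λ a∈ b∈ → inj (there a∈) (there b∈)) xs!

  length-≤-injection : ∀ {xs ys} → Unique xs → InjectiveOn xs → (∀ b → b ∈ ys) → length xs ≤ length ys
  length-≤-injection {xs} {ys} xs! inj ys-complete = begin
    length xs         ≡⟨ sym (length-map f xs) ⟩
    length (map f xs) ≤⟨ length-mono-⊆ (map⁺-injectiveOn inj xs!) (λ _ → ys-complete _) ⟩
    length ys         ∎
    where open ≤-Reasoning

  length-filter-map : ∀ {p} {P : Pred B p} (P? : Decidable P) xs →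
                      length (filter P? (map f xs)) ≡ length (filter (P? ∘ f) xs)
  length-filter-map P? []       = refl
  length-filter-map P? (x ∷ xs) with does (P? (f x))
  ... | true  = cong suc (length-filter-map P? xs)
  ... | false = length-filter-map P? xs

  preimage : ∀ {xs} ys → All (_∈ map f xs) ys → ∃ λ zs → ys ≡ map f zs
  preimage []       []             = [] , refl
  preimage (y ∷ ys) (y∈ ∷ ys∈) with ∈-map⁻ f y∈ | preimage ys ys∈
  ... | z , _ , refl | zs , refl = z ∷ zs , refl

module _ {A B : Set} where

  length-cartesianProduct : (xs : List A) (ys : List B) →
                            length (cartesianProduct xs ys) ≡ length xs * length ys
  length-cartesianProduct []       ys = refl
  length-cartesianProduct (x ∷ xs) ys = begin
    length (map (x ,_) ys ++ᴸ cartesianProduct xs ys)        ≡⟨ length-++ (map (x ,_) ys) ⟩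
    length (map (x ,_) ys) + length (cartesianProduct xs ys) ≡⟨ cong₂ _+_ (length-map (x ,_) ys) (length-cartesianProduct xs ys) ⟩
    length ys + length xs * length ys                         ∎
    where open ≡-Reasoning

∣p++q∣≡∣p∣+∣q∣ : ∀ {a b} (p : Subset a) (q : Subset b) → ∣ p ++ q ∣ ≡ ∣ p ∣ + ∣ q ∣
∣p++q∣≡∣p∣+∣q∣ []            q = refl
∣p++q∣≡∣p∣+∣q∣ (inside  ∷ p) q = cong suc (∣p++q∣≡∣p∣+∣q∣ p q)
∣p++q∣≡∣p∣+∣q∣ (outside ∷ p) q = ∣p++q∣≡∣p∣+∣q∣ p q

-- Fin (r * M) is viewed as r layers of M vertices, combine i w being the
-- w-th vertex of layer i.
transversal : ∀ {r M} → (Fin r → Fin M) → Subset (r * M)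
transversal {zero}  a = []
transversal {suc r} a = ⁅ a zero ⁆ ++ transversal (a ∘ suc)

∣transversal∣ : ∀ {r M} (a : Fin r → Fin M) → ∣ transversal a ∣ ≡ r
∣transversal∣ {zero}  a = refl
∣transversal∣ {suc r} a =
  trans (∣p++q∣≡∣p∣+∣q∣ ⁅ a zero ⁆ (transversal (a ∘ suc)))
        (cong₂ _+_ (∣⁅x⁆∣≡1 (a zero)) (∣transversal∣ (a ∘ suc)))

lookup-transversal : ∀ {r M} (a : Fin r → Fin M) i w → lookup (transversal a) (combine i w) ≡ lookup ⁅ a i ⁆ w
lookup-transversal a zero    w = lookup-++ˡ ⁅ a zero ⁆ (transversal (a ∘ suc)) w
lookup-transversal a (suc i) w =
  trans (lookup-++ʳ ⁅ a zero ⁆ (transversal (a ∘ suc)) (combine i w)) (lookup-transversal (a ∘ suc) i w)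

module _ {r M : ℕ} where

  layer : Fin (r * M) → Fin r
  layer v = proj₁ (remQuot {r} M v)

  ∈-transversal⁺ : (a : Fin r → Fin M) (i : Fin r) → combine i (a i) ∈ˢ transversal a
  ∈-transversal⁺ a i = lookup⇒[]= (combine i (a i)) (transversal a)
    (trans (lookup-transversal a i (a i)) ([]=⇒lookup (x∈⁅x⁆ (a i))))

  ∈-transversal⁻ : (a : Fin r → Fin M) {v : Fin (r * M)} → v ∈ˢ transversal a → v ≡ combine (layer v) (a (layer v))
  ∈-transversal⁻ a {v} v∈a = trans (sym iw≡v) (cong (combine i) w≡ai)
    where
    i = layer v
    w = proj₂ (remQuot {r} M v)
    iw≡v : combine i w ≡ v
    iw≡v = combine-remQuot {r} M v
    w≡ai : w ≡ a i
    w≡ai = x∈⁅y⁆⇒x≡y (a i) (lookup⇒[]= w ⁅ a i ⁆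
      (trans (sym (lookup-transversal a i w)) ([]=⇒lookup (subst (_∈ˢ transversal a) (sym iw≡v) v∈a))))

  ∈-transversal-agree : (a b : Fin r → Fin M) {v : Fin (r * M)} →
                        v ∈ˢ transversal a → v ∈ˢ transversal b → a (layer v) ≡ b (layer v)
  ∈-transversal-agree a b {v} v∈a v∈b = combine-injectiveʳ (layer v) (a (layer v)) (layer v) (b (layer v))
    (trans (sym (∈-transversal⁻ a v∈a)) (∈-transversal⁻ b v∈b))

  transversal-injective : {a b : Fin r → Fin M} → transversal a ≡ transversal b → ∀ i → a i ≡ b i
  transversal-injective {a} {b} ta≡tb i =
    subst (λ j → a j ≡ b j) (cong proj₁ (remQuot-combine i (a i)))
      (∈-transversal-agree a b (∈-transversal⁺ a i) (subst (combine i (a i) ∈ˢ_) ta≡tb (∈-transversal⁺ a i)))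

  AgreeOnlyAt : (a b : Fin r → Fin M) → Fin r → Set
  AgreeOnlyAt a b j = a j ≡ b j × (∀ i → a i ≡ b i → i ≡ j)

  transversal-∩ : {a b : Fin r → Fin M} {j : Fin r} → AgreeOnlyAt a b j →
                  transversal a ∩ transversal b ≡ ⁅ combine j (a j) ⁆
  transversal-∩ {a} {b} {j} (aj≡bj , only-j) = ⊆-antisym ∩⊆⁅⁆ ⁅⁆⊆∩
    where
    ∩⊆⁅⁆ : ∀ {v} → v ∈ˢ transversal a ∩ transversal b → v ∈ˢ ⁅ combine j (a j) ⁆
    ∩⊆⁅⁆ {v} v∈ with x∈p∩q⁻ (transversal a) (transversal b) v∈
    ... | v∈a , v∈b with only-j (layer v) (∈-transversal-agree a b v∈a v∈b)
    ... | refl = subst (_∈ˢ ⁅ combine j (a j) ⁆) (sym (∈-transversal⁻ a v∈a)) (x∈⁅x⁆ (combine j (a j)))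
    ⁅⁆⊆∩ : ∀ {v} → v ∈ˢ ⁅ combine j (a j) ⁆ → v ∈ˢ transversal a ∩ transversal b
    ⁅⁆⊆∩ v∈ with x∈⁅y⁆⇒x≡y (combine j (a j)) v∈
    ... | refl = x∈p∩q⁺ (∈-transversal⁺ a j ,
                         subst (λ w → combine j w ∈ˢ transversal b) (sym aj≡bj) (∈-transversal⁺ b j))

  ∣transversal-∩∣ : {a b : Fin r → Fin M} {j : Fin r} → AgreeOnlyAt a b j → ∣ transversal a ∩ transversal b ∣ ≡ 1
  ∣transversal-∩∣ {a} {b} {j} agree = trans (cong ∣_∣ (transversal-∩ agree)) (∣⁅x⁆∣≡1 (combine j (a j)))

  transversal-∩-∩ : {a b c : Fin r → Fin M} → (∀ i → ¬ (a i ≡ b i × b i ≡ c i)) →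
                    transversal a ∩ transversal b ∩ transversal c ≡ ⊥
  transversal-∩-∩ {a} {b} {c} never = Empty-unique λ (v , v∈) →
    let v∈a , v∈b∩c = x∈p∩q⁻ (transversal a) (transversal b ∩ transversal c) v∈
        v∈b , v∈c   = x∈p∩q⁻ (transversal b) (transversal c) v∈b∩c
    in never (layer v) (∈-transversal-agree a b v∈a v∈b , ∈-transversal-agree b c v∈b v∈c)

module Grid (m : ℕ) where

  Point : Set
  Point = Fin m × Fin m × Fin m

  _≟ᴾ_ : (s t : Point) → Dec (s ≡ t)
  _≟ᴾ_ = ≡-dec _≟_ (≡-dec _≟_ _≟_)

  open import Data.List.Membership.DecPropositional _≟ᴾ_ using (_∈?_)

  length-allFin : length (allFin m) ≡ m
  length-allFin = length-tabulate id

  pairs : List (Fin m × Fin m)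
  pairs = cartesianProduct (allFin m) (allFin m)

  points : List Point
  points = cartesianProduct (allFin m) pairs

  ∈-pairs : ∀ q → q ∈ pairs
  ∈-pairs (x , y) = ∈-cartesianProduct⁺ (∈-allFin x) (∈-allFin y)

  ∈-points : ∀ t → t ∈ points
  ∈-points (x , q) = ∈-cartesianProduct⁺ (∈-allFin x) (∈-pairs q)

  pairs-unique : Unique pairs
  pairs-unique = Unique.cartesianProduct⁺ (Unique.allFin⁺ m) (Unique.allFin⁺ m)

  points-unique : Unique points
  points-unique = Unique.cartesianProduct⁺ (Unique.allFin⁺ m) pairs-unique

  length-pairs : length pairs ≡ m * m
  length-pairs = trans (length-cartesianProduct (allFin m) (allFin m)) (cong₂ _*_ length-allFin length-allFin)

  length-points : length points ≡ m * (m * m)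
  length-points = trans (length-cartesianProduct (allFin m) pairs) (cong₂ _*_ length-allFin length-pairs)

  coordinate : Fin 3 → Point → Fin m
  coordinate 0F (x , _ , _) = x
  coordinate 1F (_ , y , _) = y
  coordinate 2F (_ , _ , z) = z

  rest : Fin 3 → Point → Fin m × Fin m
  rest 0F (_ , y , z) = y , z
  rest 1F (x , _ , z) = x , z
  rest 2F (x , y , _) = x , y

  place : Fin 3 → Fin m → Fin m × Fin m → Point
  place 0F x (y , z) = x , y , z
  place 1F y (x , z) = x , y , z
  place 2F z (x , y) = x , y , z

  place-coordinate-rest : ∀ d t → place d (coordinate d t) (rest d t) ≡ t
  place-coordinate-rest 0F t = refl
  place-coordinate-rest 1F t = refl
  place-coordinate-rest 2F t = refl

  coordinate-rest-injective : ∀ d {s t} → coordinate d s ≡ coordinate d t → rest d s ≡ rest d t → s ≡ t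
  coordinate-rest-injective d {s} {t} c≡ r≡ =
    trans (sym (place-coordinate-rest d s)) (trans (cong₂ (place d) c≡ r≡) (place-coordinate-rest d t))

  Neighbour : List Point → Fin 3 → Point → Set
  Neighbour ps d t = ∃ λ c → c ≢ coordinate d t × place d c (rest d t) ∈ ps

  neighbour? : ∀ ps d t → Dec (Neighbour ps d t)
  neighbour? ps d t = any? λ c → ¬? (c ≟ coordinate d t) ×-dec (place d c (rest d t) ∈? ps)

  Centre : List Point → Point → Set
  Centre ps t = ∀ d → Neighbour ps d t

  lonely : List Point → Fin 3 → List Point
  lonely ps d = filter (¬? ∘ neighbour? ps d) ps

  length-lonely : ∀ {ps} → Unique ps → ∀ d → length (lonely ps d) ≤ m * m
  length-lonely {ps} ps! d =
    ≤-trans (length-≤-injection (rest d) (Unique.filter⁺ _ ps!) injective ∈-pairs) (≤-reflexive length-pairs)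
    where
    injective : InjectiveOn (rest d) (lonely ps d)
    injective {s} {t} s∈ t∈ r≡
      with ∈-filter⁻ (¬? ∘ neighbour? ps d) {xs = ps} s∈ | ∈-filter⁻ (¬? ∘ neighbour? ps d) {xs = ps} t∈
    ... | _ , s-lonely | t∈ps , _ with coordinate d t ≟ coordinate d s
    ...   | yes c≡ = coordinate-rest-injective d (sym c≡) r≡
    ...   | no  c≢ = ⊥-elim (s-lonely (coordinate d t , c≢ ,
                       subst (_∈ ps) (sym (trans (cong (place d (coordinate d t)) r≡) (place-coordinate-rest d t))) t∈ps))

  lonely-somewhere : ∀ {ps t} → ¬ Centre ps t → ∃ λ d → ¬ Neighbour ps d t
  lonely-somewhere {ps} {t} = ¬∀⟶∃¬ 3 (λ d → Neighbour ps d t) (λ d → neighbour? ps d t)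

  centreFree⇒length≤ : ∀ {ps} → Unique ps → (∀ t → ¬ Centre ps t) → length ps ≤ 3 * (m * m)
  centreFree⇒length≤ {ps} ps! centreFree = begin
    length ps                                               ≤⟨ length-mono-⊆ ps! ps⊆lonely ⟩
    length (lonely ps 0F ++ᴸ lonely ps 1F ++ᴸ lonely ps 2F) ≡⟨ length-++ (lonely ps 0F) ⟩
    length (lonely ps 0F) + length (lonely ps 1F ++ᴸ lonely ps 2F)
                                                            ≡⟨ cong (length (lonely ps 0F) +_) (length-++ (lonely ps 1F)) ⟩
    length (lonely ps 0F) + (length (lonely ps 1F) + length (lonely ps 2F))
                                                            ≤⟨ +-mono-≤ (length-lonely ps! 0F) (+-mono-≤ (length-lonely ps! 1F) (length-lonely ps! 2F)) ⟩
    m * m + (m * m + m * m)                                 ≡⟨ cong (λ q → m * m + (m * m + q)) (sym (+-identityʳ (m * m))) ⟩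
    3 * (m * m)                                             ∎
    where
    open ≤-Reasoning
    ps⊆lonely : ps ⊆ lonely ps 0F ++ᴸ lonely ps 1F ++ᴸ lonely ps 2F
    ps⊆lonely {t} t∈ps with lonely-somewhere (centreFree t)
    ... | 0F , ¬n = ∈-++⁺ˡ (∈-filter⁺ (¬? ∘ neighbour? ps 0F) t∈ps ¬n)
    ... | 1F , ¬n = ∈-++⁺ʳ (lonely ps 0F) (∈-++⁺ˡ (∈-filter⁺ (¬? ∘ neighbour? ps 1F) t∈ps ¬n))
    ... | 2F , ¬n = ∈-++⁺ʳ (lonely ps 0F) (∈-++⁺ʳ (lonely ps 1F) (∈-filter⁺ (¬? ∘ neighbour? ps 2F) t∈ps ¬n))

-- The vertices form 3 + k layers of size M = m³: the edge of t = (x, y, z)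
-- takes x, y, z in the first three layers and the code of t in each of the k
-- private layers.
module Expansion (m′ k : ℕ) where

  m : ℕ
  m = suc m′

  open Grid m

  M r n : ℕ
  M = m * (m * m)
  r = 3 + k
  n = r * M

  ι : Fin m → Fin M
  ι x = inject≤ x (m≤m*n m (m * m))

  ι-injective : ∀ {x y} → ι x ≡ ι y → x ≡ y
  ι-injective {x} {y} = inject≤-injective _ _ x y

  code : Point → Fin M
  code (x , y , z) = combine x (combine y z)

  code-injective : ∀ {s t} → code s ≡ code t → s ≡ t
  code-injective {x , y , z} {x′ , y′ , z′} eq
    with refl , eq′ ← combine-injective x (combine y z) x′ (combine y′ z′) eq
    with refl , refl ← combine-injective y z y′ z′ eq′ = refl

  coords : Point → Fin r → Fin M
  coords (x , _ , _) 0F                  = ι x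
  coords (_ , y , _) 1F                  = ι y
  coords (_ , _ , z) 2F                  = ι z
  coords t           (suc (suc (suc _))) = code t

  edge : Point → Subset n
  edge t = transversal (coords t)

  edge-injective : ∀ {s t} → edge s ≡ edge t → s ≡ t
  edge-injective {s} {t} edge≡ =
    cong₂ _,_ (ι-injective (same 0F)) (cong₂ _,_ (ι-injective (same 1F)) (ι-injective (same 2F)))
    where same = transversal-injective {a = coords s} {b = coords t} edge≡

  G : RGraph r n
  G = record
    { edges    = map edge points
    ; uniform  = All.map⁺ (All.universal (∣transversal∣ ∘ coords) points)
    ; distinct = Unique.map⁺ edge-injective points-unique
    }

  e-G : e G ≡ m * (m * m)
  e-G = trans (length-map edge points) length-points

  -- On a private layer the vertex alone determines the point, so any key will do.
  key : Fin r → Point → Fin m × Fin m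
  key 0F                  = rest 0F
  key 1F                  = rest 1F
  key 2F                  = rest 2F
  key (suc (suc (suc _))) = rest 0F

  coords-key-injective : ∀ i {s t} → coords s i ≡ coords t i → key i s ≡ key i t → s ≡ t
  coords-key-injective 0F                  c≡ k≡ = coordinate-rest-injective 0F (ι-injective c≡) k≡
  coords-key-injective 1F                  c≡ k≡ = coordinate-rest-injective 1F (ι-injective c≡) k≡
  coords-key-injective 2F                  c≡ k≡ = coordinate-rest-injective 2F (ι-injective c≡) k≡
  coords-key-injective (suc (suc (suc _))) c≡ _  = code-injective c≡

  layerOf : Fin n → Fin r
  layerOf = layer {r} {M}

  star : Fin n → List Point
  star v = filter (λ t → v ∈ˢ? edge t) points

  degree-star : ∀ v → degree G v ≡ length (star v)
  degree-star v = length-filter-map edge (v ∈ˢ?_) points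

  degree-≤ : ∀ v → degree G v ≤ m * m
  degree-≤ v = begin
    degree G v         ≡⟨ degree-star v ⟩
    length (star v)    ≤⟨ length-≤-injection (key (layerOf v)) star-unique injective ∈-pairs ⟩
    length pairs       ≡⟨ length-pairs ⟩
    m * m              ∎
    where
    open ≤-Reasoning
    star-unique : Unique (star v)
    star-unique = Unique.filter⁺ (λ t → v ∈ˢ? edge t) points-unique
    v∈edge : ∀ {t} → t ∈ star v → v ∈ˢ edge t
    v∈edge = proj₂ ∘ ∈-filter⁻ (λ t → v ∈ˢ? edge t) {xs = points}
    injective : InjectiveOn (key (layerOf v)) (star v)
    injective {s} {t} s∈ t∈ =
      coords-key-injective (layerOf v) (∈-transversal-agree (coords s) (coords t) (v∈edge s∈) (v∈edge t∈))

  hub : Fin n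
  hub = combine {m = r} 0F (ι zero)

  star-hub : map (zero ,_) pairs ⊆ star hub
  star-hub t∈ with ∈-map⁻ (zero ,_) t∈
  ... | q , _ , refl = ∈-filter⁺ (λ t → hub ∈ˢ? edge t) (∈-points (zero , q)) (∈-transversal⁺ (coords (zero , q)) 0F)

  degree-hub : m * m ≤ degree G hub
  degree-hub = begin
    m * m                         ≡⟨ sym length-pairs ⟩
    length pairs                  ≡⟨ sym (length-map (zero ,_) pairs) ⟩
    length (map (zero ,_) pairs)  ≤⟨ length-mono-⊆ (Unique.map⁺ (cong proj₂) pairs-unique) star-hub ⟩
    length (star hub)             ≡⟨ sym (degree-star hub) ⟩
    degree G hub                  ∎
    where open ≤-Reasoning

  maxDegree : MaxDegree G (m * m)
  maxDegree = degree-≤ , hub , ≤-antisym (degree-≤ hub) degree-hub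

  agreeOnlyAt₀ : ∀ {x y z y′ z′} → y ≢ y′ → z ≢ z′ → AgreeOnlyAt (coords (x , y , z)) (coords (x , y′ , z′)) 0F
  agreeOnlyAt₀ {x} {y} {z} {y′} {z′} y≢y′ z≢z′ = refl , λ
    { 0F                  _  → refl
    ; 1F                  eq → ⊥-elim (y≢y′ (ι-injective eq))
    ; 2F                  eq → ⊥-elim (z≢z′ (ι-injective eq))
    ; (suc (suc (suc _))) eq → ⊥-elim (y≢y′ (cong (proj₁ ∘ proj₂) (code-injective {x , y , z} {x , y′ , z′} eq)))
    }

  agreeOnlyAt₁ : ∀ {x y z x′ z′} → x ≢ x′ → z ≢ z′ → AgreeOnlyAt (coords (x , y , z)) (coords (x′ , y , z′)) 1F
  agreeOnlyAt₁ {x} {y} {z} {x′} {z′} x≢x′ z≢z′ = refl , λ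
    { 0F                  eq → ⊥-elim (x≢x′ (ι-injective eq))
    ; 1F                  _  → refl
    ; 2F                  eq → ⊥-elim (z≢z′ (ι-injective eq))
    ; (suc (suc (suc _))) eq → ⊥-elim (x≢x′ (cong proj₁ (code-injective {x , y , z} {x′ , y , z′} eq)))
    }

  agreeOnlyAt₂ : ∀ {x y z x′ y′} → x ≢ x′ → y ≢ y′ → AgreeOnlyAt (coords (x , y , z)) (coords (x′ , y′ , z)) 2F
  agreeOnlyAt₂ {x} {y} {z} {x′} {y′} x≢x′ y≢y′ = refl , λ
    { 0F                  eq → ⊥-elim (x≢x′ (ι-injective eq))
    ; 1F                  eq → ⊥-elim (y≢y′ (ι-injective eq))
    ; 2F                  _  → refl
    ; (suc (suc (suc _))) eq → ⊥-elim (x≢x′ (cong proj₁ (code-injective {x , y , z} {x′ , y′ , z} eq)))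
    }

  centre⇒looseTriangle : (H : RGraph r n) {ts : List Point} → (∀ {t} → t ∈ ts → edge t ∈ edges H) →
                         ∀ {t} → Centre ts t → ContainsLooseTriangle H
  centre⇒looseTriangle H ts⊆H {x , y , z} centre
    with x′ , x′≢x , s₀∈ ← centre 0F
       | y′ , y′≢y , s₁∈ ← centre 1F
       | z′ , z′≢z , s₂∈ ← centre 2F =
    edge (x′ , y , z) , edge (x , y′ , z) , edge (x , y , z′) ,
    ts⊆H s₀∈ , ts⊆H s₁∈ , ts⊆H s₂∈ ,
    ∣transversal-∩∣ s₀s₁ , ∣transversal-∩∣ s₁s₂ , ∣transversal-∩∣ s₂s₀ ,
    transversal-∩-∩ λ i (s₀≡s₁ , s₁≡s₂) →
      2≢0 (trans (sym (proj₂ s₀s₁ i s₀≡s₁)) (proj₂ s₁s₂ i s₁≡s₂))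
    where
    s₀s₁ = agreeOnlyAt₂ {x′} {y} {z} {x} {y′} x′≢x (y′≢y ∘ sym)
    s₁s₂ = agreeOnlyAt₀ {x} {y′} {z} {y} {z′} y′≢y (z′≢z ∘ sym)
    s₂s₀ = agreeOnlyAt₁ {x} {y} {z′} {x′} {z} (x′≢x ∘ sym) z′≢z
    2≢0 : _≢_ {A = Fin r} 2F 0F
    2≢0 ()

  looseTriangleFree⇒e≤ : (H : RGraph r n) → SubgraphOf H G → ¬ ContainsLooseTriangle H → e H ≤ 3 * (m * m)
  looseTriangleFree⇒e≤ H H⊆G free with preimage edge {points} (edges H) H⊆G
  ... | ts , edges≡ = begin
    e H                    ≡⟨ cong length edges≡ ⟩
    length (map edge ts)   ≡⟨ length-map edge ts ⟩
    length ts              ≤⟨ centreFree⇒length≤ ts! (λ _ → free ∘ centre⇒looseTriangle H ts⊆H) ⟩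
    3 * (m * m)            ∎
    where
    open ≤-Reasoning
    ts! : Unique ts
    ts! = Unique.map⁻ (subst Unique edges≡ (distinct H))
    ts⊆H : ∀ {t} → t ∈ ts → edge t ∈ edges H
    ts⊆H t∈ = subst (_ ∈_) (sym edges≡) (∈-map⁺ edge t∈)

[cq²]²q²≡c²[q³]² : ∀ c q → c * (q * q) * (c * (q * q)) * (q * q) ≡ c * c * (q * (q * q) * (q * (q * q)))
[cq²]²q²≡c²[q³]² = solve-∀

proposition1p3 : (r : ℕ) → 4 ≤ r →
    Σ ℕ λ C → (D : ℕ) → Σ ℕ λ Δ → D ≤ Δ × Σ ℕ λ n → Σ (RGraph r n) λ G →
    MaxDegree G Δ ×
    ((H : RGraph r n) → SubgraphOf H G → ¬ ContainsLooseTriangle H → e H * e H * Δ ≤ C * C * (e G * e G))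
proposition1p3 (suc (suc (suc (suc k)))) (s≤s (s≤s (s≤s (s≤s _)))) = 3 , λ D →
  let open Expansion D (suc k) in
  m * m , ≤-trans (n≤1+n D) (m≤m*n m m) , n , G , maxDegree , λ H H⊆G free →
    let eH≤ = looseTriangleFree⇒e≤ H H⊆G free in
    subst (λ g → e H * e H * (m * m) ≤ 3 * 3 * (g * g)) (sym e-G)
      (≤-trans (*-mono-≤ (*-mono-≤ eH≤ eH≤) ≤-refl) (≤-reflexive ([cq²]²q²≡c²[q³]² 3 m)))
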